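{- Let $\delta\in\{\mathrm{I},\mathrm{D},\mathrm{U},\mathrm{X}\}^n$. The map sending a $\delta$-permutree $T$ on $n$ nodes to its cubic vector $\vec c(T)\in\mathbb{Z}^{n-1}$ is injective.
   Context: Decorations: $\mathrm{I}$ (one parent, one child), $\mathrm{D}$ (one parent, two children), $\mathrm{U}$ (two parents, one child), $\mathrm{X}$ (two parents, two children). A $\delta$-permutree is a directed tree on nodes $v_1,\dots,v_n$ (with dangling leaf/root edges allowed, so a neighbour slot may be empty) in which $v_i$ has two parent slots if $\delta_i\in\{\mathrm{U},\mathrm{X}\}$ and one otherwise, and two child slots if $\delta_i\in\{\mathrm{D},\mathrm{X}\}$ and one otherwise. Removing $v_i$, each slot determines a (possibly empty) subtree, consisting of the nodes in the connected component reached through that slot; when there are two child slots the left descendant subtree $LD_i$ has all labels $<i$ and the right descendant subtree $RD_i$ all labels $>i$ (similarly for two parents). If $v_i$ has one child slot, $D_i$ denotes its descendant subtree. The cubic set of $T$ is $C(T):=\{(i,j): i<j \text{ and } v_j\in D_i\}$ for those $i$ with $\delta_i\in\{\mathrm{I},\mathrm{U}\}$, together with $\{(i,j): v_j\in RD_i\}$ for those $i$ with $\delta_i\in\{\mathrm{D},\mathrm{X}\}$. The cubic vector is $\vec c(T)=(c_1,\dots,c_{n-1})$ with $c_i=|\{j:(i,j)\in C(T)\}|$. -}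

module Defs where

open import Data.Nat using (ℕ; zero; suc; _∸_)
open import Data.Bool using (Bool; true; false)
open import Data.Fin using (Fin; _<_; inject₁)
open import Data.Fin.Subset using (Subset; _∈_; ∣_∣)
open import Data.Product using (Σ; _×_; _,_)
open import Data.Sum using (_⊎_)
open import Relation.Nullary using (¬_)
open import Relation.Binary.PropositionalEquality using (_≡_)
open import Function.Bundles using (_⇔_)

data Decoration : Set where
  I D U X : Decoration

twoParents : Decoration → Bool
twoParents U = true
twoParents X = true
twoParents _ = false

twoChildren : Decoration → Bool
twoChildren D = true
twoChildren X = true
twoChildren _ = false

data Walk {n : ℕ} (R : Fin n → Fin n → Set) : Fin n → Fin n → Set where
  here : ∀ {a} → Walk R a a
  step : ∀ {a b c} → R a b → Walk R b c → Walk R a c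

-- Orientation convention: E p c ≡ true  means  v_p is a parent of v_c
-- (there is a directed edge between v_p and v_c, v_c the child).
Adj : {n : ℕ} → (Fin n → Fin n → Bool) → Fin n → Fin n → Set
Adj E x y = E x y ≡ true ⊎ E y x ≡ true

AdjAvoid : {n : ℕ} → (Fin n → Fin n → Bool) → Fin n → Fin n → Fin n → Set
AdjAvoid E v x y = Adj E x y × ¬ x ≡ v × ¬ y ≡ v

AdjWithout : {n : ℕ} → (Fin n → Fin n → Bool) → Fin n → Fin n → Fin n → Fin n → Set
AdjWithout E a b x y = Adj E x y × ¬ ((x ≡ a × y ≡ b) ⊎ (x ≡ b × y ≡ a))

-- Sub E i w x : after removing v_i, the node v_x lies in the connected
-- component reached through the neighbour v_w of v_i (i.e. the subtree
-- through the slot occupied by v_w).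
Sub : {n : ℕ} → (Fin n → Fin n → Bool) → Fin n → Fin n → Fin n → Set
Sub E i w x = Walk (AdjAvoid E i) w x

-- Two slots: every such neighbour sits in the left slot (its subtree has all
-- labels < i) or in the right slot (all labels > i), each slot holding at
-- most one neighbour.
Slots : {n : ℕ} → Bool → Fin n → (Fin n → Set) → (Fin n → Fin n → Set) → Set
Slots false i Nb Sb = ∀ p q → Nb p → Nb q → p ≡ q
Slots true  i Nb Sb =
  (∀ p → Nb p → (∀ x → Sb p x → x < i) ⊎ (∀ x → Sb p x → i < x))
  × (∀ p q → Nb p → Nb q → p < i → q < i → p ≡ q)
  × (∀ p q → Nb p → Nb q → i < p → i < q → p ≡ q)

-- A δ-permutree on nodes v_1..v_n (labels Fin n), given by its (labelled,
-- oriented) edges; dangling edges are implicit (empty slots).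
record Permutree {n : ℕ} (δ : Fin n → Decoration) : Set where
  field
    parent      : Fin n → Fin n → Bool
    antisym     : ∀ a b → parent a b ≡ true → parent b a ≡ false
    connected   : ∀ a b → Walk (Adj parent) a b
    acyclic     : ∀ a b → parent a b ≡ true → ¬ Walk (AdjWithout parent a b) a b
    parentSlots : ∀ i → Slots (twoParents (δ i)) i (λ p → parent p i ≡ true) (Sub parent i)
    childSlots  : ∀ i → Slots (twoChildren (δ i)) i (λ c → parent i c ≡ true) (Sub parent i)

open Permutree public

-- (i , j) ∈ C(T)
--  * one child slot (δ_i ∈ {I,U}):  i < j and v_j ∈ D_i (subtree through the child)
--  * two child slots (δ_i ∈ {D,X}): v_j ∈ RD_i (subtree through the right child,
--    i.e. through the child c with i < c)
CubicAt : {n : ℕ} → Bool → (Fin n → Fin n → Bool) → Fin n → Fin n → Set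
CubicAt false E i j = i < j × Σ _ λ c → E i c ≡ true × Sub E i c j
CubicAt true  E i j = Σ _ λ c → E i c ≡ true × i < c × Sub E i c j

InC : {n : ℕ} {δ : Fin n → Decoration} → Permutree δ → Fin n → Fin n → Set
InC {δ = δ} T i j = CubicAt (twoChildren (δ i)) (parent T) i j

node : {n : ℕ} → Fin (n ∸ 1) → Fin n
node {suc n} i = inject₁ i

IsCubicVector : {n : ℕ} {δ : Fin n → Decoration} → Permutree δ → (Fin (n ∸ 1) → ℕ) → Set
IsCubicVector {n} T c =
  ∀ i → Σ (Subset n) λ S → (∀ j → (j ∈ S) ⇔ InC T (node i) j) × ∣ S ∣ ≡ c i

{-# OPTIONS --safe #-}
-- Write Toward o x y when y lies beyond an o-neighbour of x (a child for o = down, a parent for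
-- o = up). Along increasing labels Toward o is transitive: if the orientation switched on the way,
-- the switching node would carry two in-neighbours of one slot side whose subtrees interleave in
-- label order, against the slot conditions. Since C(T) = {(i,j) : i < j, Toward down i j}, both
-- C(T) and its complement are transitive, so two candidate rows i of equal size c_i that agree on
-- all later rows cannot cross, hence coincide; descending induction recovers C(T), i.e. the
-- orientation of every pair. Finally an edge p q of one tree is an edge of every tree with the
-- same orientations: the other tree's first step from p towards q, if not q, would violate a slot
-- condition in one of the two trees, whichever side of p and q it lies on.
module Submission where

open import Defs
open import Data.Bool using (Bool; true; false)
open import Data.Bool.Properties using (⇔→≡)
open import Data.Empty using (⊥; ⊥-elim)
open import Data.Fin using (Fin; _<_; fromℕ)
open import Data.Fin.Induction using (>-wellFounded)
open import Data.Fin.Properties using (_≟_; <-asym; <-trans; <-cmp; <⇒≢; ≤fromℕ)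
open import Data.Fin.Relation.Unary.Top using (view; ‵fromℕ; ‵inj₁)
open import Data.Fin.Subset using (Subset; _∈_; _⊆_; ∣_∣)
open import Data.Fin.Subset.Properties using (_∈?_; p⊂q⇒∣p∣<∣q∣)
open import Data.Nat as ℕ using (ℕ; zero; suc; _∸_; z≤n; s≤s)
open import Data.Nat.Properties as ℕ using (m≤n⇒m≤1+n)
open import Data.Product using (Σ; _×_; _,_; proj₁; proj₂; swap)
open import Data.Sum using (_⊎_; inj₁; inj₂; [_,_])
open import Function.Bundles using (_⇔_; Equivalence; mk⇔)
open import Induction.WellFounded using (module All)
open import Relation.Binary.Definitions using (tri<; tri≈; tri>)
open import Relation.Binary.PropositionalEquality using (_≡_; _≢_; refl; sym; trans; ≢-sym)
open import Relation.Nullary using (¬_; yes; no)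

module _ {n : ℕ} where

  _◅◅_ : ∀ {R : Fin n → Fin n → Set} {a b c} → Walk R a b → Walk R b c → Walk R a c
  here ◅◅ q = q
  step r p ◅◅ q = step r (p ◅◅ q)

  _▻_ : ∀ {R : Fin n → Fin n → Set} {a b c} → Walk R a b → R b c → Walk R a c
  p ▻ r = p ◅◅ step r here

  gmap : ∀ {R S : Fin n → Fin n → Set} → (∀ {x y} → R x y → S x y) → ∀ {a b} → Walk R a b → Walk S a b
  gmap f here = here
  gmap f (step r p) = step (f r) (gmap f p)

  reverse : ∀ {R : Fin n → Fin n → Set} → (∀ {x y} → R x y → R y x) → ∀ {a b} → Walk R a b → Walk R b a
  reverse sym-R here = here
  reverse sym-R (step r p) = reverse sym-R p ▻ sym-R r

  length : ∀ {R : Fin n → Fin n → Set} {a b} → Walk R a b → ℕ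
  length here = 0
  length (step _ p) = suc (length p)

data Dir : Set where
  down up : Dir

opposite : Dir → Dir
opposite down = up
opposite up = down

twoSlots : Dir → Decoration → Bool
twoSlots down = twoChildren
twoSlots up = twoParents

module Tree {n : ℕ} (E : Fin n → Fin n → Bool)
  (antisym : ∀ a b → E a b ≡ true → E b a ≡ false)
  (connected : ∀ a b → Walk (Adj E) a b)
  (acyclic : ∀ a b → E a b ≡ true → ¬ Walk (AdjWithout E a b) a b) where

  adj-sym : ∀ {x y} → Adj E x y → Adj E y x
  adj-sym (inj₁ e) = inj₂ e
  adj-sym (inj₂ e) = inj₁ e

  adj-irrefl : ∀ {x} → ¬ Adj E x x
  adj-irrefl {x} (inj₁ e) with () ← trans (sym e) (antisym x x e)
  adj-irrefl {x} (inj₂ e) with () ← trans (sym e) (antisym x x e)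

  adj⇒≢ : ∀ {x y} → Adj E x y → x ≢ y
  adj⇒≢ a refl = adj-irrefl a

  avoid-sym : ∀ {v x y} → AdjAvoid E v x y → AdjAvoid E v y x
  avoid-sym (a , x≢v , y≢v) = adj-sym a , y≢v , x≢v

  sub-≢ : ∀ {x w y} → Adj E x w → Sub E x w y → y ≢ x
  sub-≢ a s = avoiding s (≢-sym (adj⇒≢ a))
    where
    avoiding : ∀ {x a y} → Walk (AdjAvoid E x) a y → a ≢ x → y ≢ x
    avoiding here a≢x = a≢x
    avoiding (step (_ , _ , b≢x) p) _ = avoiding p b≢x

  without-flip : ∀ {a b x y} → AdjWithout E a b x y → AdjWithout E b a x y
  without-flip (a , ne) = a , λ { (inj₁ eqs) → ne (inj₂ eqs) ; (inj₂ eqs) → ne (inj₁ eqs) }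

  without-sym : ∀ {a b x y} → AdjWithout E a b x y → AdjWithout E a b y x
  without-sym (a , ne) = adj-sym a , λ { (inj₁ (p , q)) → ne (inj₂ (q , p)) ; (inj₂ (p , q)) → ne (inj₁ (q , p)) }

  avoid⇒withoutˡ : ∀ {x w u v} → AdjAvoid E x u v → AdjWithout E x w u v
  avoid⇒withoutˡ (a , u≢x , v≢x) = a , λ { (inj₁ (u≡x , _)) → u≢x u≡x ; (inj₂ (_ , v≡x)) → v≢x v≡x }

  avoid⇒withoutʳ : ∀ {x w u v} → AdjAvoid E w u v → AdjWithout E x w u v
  avoid⇒withoutʳ (a , u≢w , v≢w) = a , λ { (inj₁ (_ , v≡w)) → v≢w v≡w ; (inj₂ (u≡w , _)) → u≢w u≡w }

  no-cycle : ∀ {x w} → Adj E x w → ¬ Walk (AdjWithout E x w) x w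
  no-cycle (inj₁ e) p = acyclic _ _ e p
  no-cycle (inj₂ e) p = acyclic _ _ e (reverse without-sym (gmap without-flip p))

  sub-unique : ∀ {x w w′ y} → Adj E x w → Adj E x w′ → Sub E x w y → Sub E x w′ y → w ≡ w′
  sub-unique {x} {w} {w′} a a′ s s′ with w ≟ w′
  ... | yes w≡w′ = w≡w′
  ... | no w≢w′ = ⊥-elim (no-cycle a (step (a′ , new-edge) (gmap avoid⇒withoutˡ (s′ ◅◅ reverse avoid-sym s))))
    where
    new-edge : ¬ ((x ≡ x × w′ ≡ w) ⊎ (x ≡ w × w′ ≡ x))
    new-edge (inj₁ (_ , w′≡w)) = w≢w′ (sym w′≡w)
    new-edge (inj₂ (x≡w , _)) = adj⇒≢ a x≡w

  sub-not-back : ∀ {x w y w₂} → Adj E x w → Sub E x w y → Adj E w w₂ → Sub E w w₂ y → w₂ ≢ x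
  sub-not-back a s a₂ s₂ refl = no-cycle a (gmap avoid⇒withoutʳ s₂ ◅◅ gmap avoid⇒withoutˡ (reverse avoid-sym s))

  last-exit : ∀ {R : Fin n → Fin n → Set} → (∀ {u v} → R u v → Adj E u v) →
              ∀ x {a y} (V : Walk R a y) → y ≢ x →
              (a ≢ x × Σ (Walk (AdjAvoid E x) a y) λ V′ → length V′ ℕ.≤ length V)
              ⊎ Σ (Fin n) λ w → Adj E x w × Σ (Walk (AdjAvoid E x) w y) λ V′ → length V′ ℕ.≤ length V
  last-exit adj x here y≢x = inj₁ (y≢x , here , z≤n)
  last-exit adj x {a} (step r V) y≢x with last-exit adj x V y≢x
  ... | inj₂ (w , aw , V′ , le) = inj₂ (w , aw , V′ , m≤n⇒m≤1+n le)
  ... | inj₁ (b≢x , V′ , le) with a ≟ x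
  ...   | yes refl = inj₂ (_ , adj r , V′ , m≤n⇒m≤1+n le)
  ...   | no a≢x = inj₁ (a≢x , step (adj r , a≢x , b≢x) V′ , s≤s le)

  sub-exists : ∀ {x y} → x ≢ y → Σ (Fin n) λ w → Adj E x w × Sub E x w y
  sub-exists {x} {y} x≢y with last-exit (λ a → a) x (connected x y) (≢-sym x≢y)
  ... | inj₁ (x≢x , _) = ⊥-elim (x≢x refl)
  ... | inj₂ (w , a , V , _) = w , a , V

  sub-extend : ∀ {m u a b} → Adj E m u → Sub E m u a → Adj E a b → b ≢ m → Sub E m u b
  sub-extend am s ab b≢m = s ▻ (ab , sub-≢ am s , b≢m)

  sub-through : ∀ {i c w m k c₂} → Adj E i c → Adj E i w → c ≢ w → Sub E i c m → Sub E i w k →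
                Adj E m c₂ → Sub E m c₂ i → Sub E m c₂ k
  sub-through {i} {c} {w} {m} ac aw c≢w sm sk am₂ si = si ◅◅ step (aw , i≢m , missing here) (restrict here sk)
    where
    i≢m : i ≢ m
    i≢m = sub-≢ am₂ si
    missing : ∀ {v} → Sub E i w v → v ≢ m
    missing sv refl = c≢w (sub-unique ac aw sm sv)
    restrict : ∀ {a b} → Sub E i w a → Walk (AdjAvoid E i) a b → Walk (AdjAvoid E m) a b
    restrict s here = here
    restrict s (step r@(ab , _ , _) V) = step (ab , missing s , missing (s ▻ r)) (restrict (s ▻ r) V)

  sub-between : ∀ {i c w j k d} → Adj E i c → Adj E i w → c ≢ w → Sub E i c j → Sub E i w k →
                Adj E j d → Sub E j d k → Sub E j d i
  sub-between ac aw c≢w sj sk ad sdk with sub-exists (sub-≢ ac sj)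
  ... | d₂ , ad₂ , sd₂ with refl ← sub-unique ad ad₂ sdk (sub-through ac aw c≢w sj sk ad₂ sd₂) = sd₂

  Step : Dir → Fin n → Fin n → Set
  Step down x w = E x w ≡ true
  Step up x w = E w x ≡ true

  step⇒adj : ∀ {o x w} → Step o x w → Adj E x w
  step⇒adj {down} e = inj₁ e
  step⇒adj {up} e = inj₂ e

  adj⇒step : ∀ o {x w} → Adj E x w → Step o x w ⊎ Step o w x
  adj⇒step down (inj₁ e) = inj₁ e
  adj⇒step down (inj₂ e) = inj₂ e
  adj⇒step up (inj₁ e) = inj₂ e
  adj⇒step up (inj₂ e) = inj₁ e

  step-asym : ∀ {o x w} → Step o x w → ¬ Step o w x
  step-asym {down} {x} {w} e e′ with () ← trans (sym e′) (antisym x w e)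
  step-asym {up} {x} {w} e e′ with () ← trans (sym e′) (antisym w x e)

  step-opposite : ∀ o {x w} → Step (opposite o) x w → Step o w x
  step-opposite down s = s
  step-opposite up s = s

  step-opposite⁻¹ : ∀ o {x w} → Step o w x → Step (opposite o) x w
  step-opposite⁻¹ down s = s
  step-opposite⁻¹ up s = s

  Toward : Dir → Fin n → Fin n → Set
  Toward o x y = Σ (Fin n) λ w → Step o x w × Sub E x w y

  toward-exclusive : ∀ o {x y} → Toward o x y → ¬ Toward (opposite o) x y
  toward-exclusive o (w , r , s) (w′ , r′ , s′) with refl ← sub-unique (step⇒adj r) (step⇒adj r′) s s′ =
    step-asym r (step-opposite o r′)

  toward-total : ∀ o {x y} → x ≢ y → Toward o x y ⊎ Toward (opposite o) x y
  toward-total o x≢y with sub-exists x≢y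
  ... | w , a , s = [ (λ r → inj₁ (w , r , s)) , (λ r → inj₂ (w , step-opposite⁻¹ o r , s)) ] (adj⇒step o a)

  toward-extend : ∀ o {p q r} → Adj E p q → r ≢ q → Toward o r p → Toward o r q
  toward-extend o pq r≢q (u , ru , s) = u , ru , sub-extend (step⇒adj ru) s pq (≢-sym r≢q)

  record Valley (o : Dir) (x y : Fin n) : Set where
    constructor valley
    field
      m c₁ c₂ : Fin n
      c₁→m : Step o c₁ m
      c₂→m : Step o c₂ m
      c₁≢c₂ : c₁ ≢ c₂
      y-via-c₁ : Sub E m c₁ y
      x-via-c₂ : Sub E m c₂ x

  valley-within : ∀ o k {x y w} → Step o x w → (V : Sub E x w y) → length V ℕ.≤ k → Toward o y x → Valley o x y
  valley-past : ∀ o k {x y w} → Step o x w → Sub E x w y → Toward o y x → y ≢ w →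
                ∀ w₂ → Adj E w w₂ → (V₂ : Sub E w w₂ y) → length V₂ ℕ.≤ k → Valley o x y

  valley-within o k {x} {y} {w} r V le (z , rz , sz) with y ≟ w
  ... | yes refl with refl ← sub-unique (step⇒adj rz) (adj-sym (step⇒adj r)) sz here = ⊥-elim (step-asym r rz)
  valley-within o k r here le tw | no y≢w = ⊥-elim (y≢w refl)
  valley-within o (suc k) {y = y} {w} r V@(step (awu , _ , _) V′) (s≤s le) tw | no y≢w
    with last-exit proj₁ w V′ y≢w
  ... | inj₁ (_ , V″ , le′) = valley-past o k r V tw y≢w _ awu V″ (ℕ.≤-trans le′ le)
  ... | inj₂ (w₂ , a₂ , V″ , le′) = valley-past o k r V tw y≢w w₂ a₂ V″ (ℕ.≤-trans le′ le)

  valley-past o k {x} {y} {w} r V (z , rz , sz) y≢w w₂ a₂ V₂ le₂ with adj⇒step o a₂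
  ... | inj₂ r₂ = valley w w₂ x r₂ r (sub-not-back (step⇒adj r) V a₂ V₂) V₂ here
  ... | inj₁ r₂ with valley-within o k r₂ V₂ le₂ (z , rz , sub-extend (step⇒adj rz) sz (step⇒adj r) (≢-sym y≢w))
  ...   | valley m c₁ c₂ q₁ q₂ c₁≢c₂ t₁ t₂ =
    valley m c₁ c₂ q₁ q₂ c₁≢c₂ t₁ (sub-extend (adj-sym (step⇒adj q₂)) t₂ (adj-sym (step⇒adj r)) x≢m)
    where
    x≢m : x ≢ m
    x≢m refl = c₁≢c₂ (trans (sub-unique (adj-sym (step⇒adj q₁)) (step⇒adj r) t₁ V)
                            (sym (sub-unique (adj-sym (step⇒adj q₂)) (step⇒adj r) t₂ here)))

  -- Along the path from x to y the orientation must switch somewhere; the switch is the valley.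
  valley-of : ∀ o {x y} → Toward o x y → Toward o y x → Valley o x y
  valley-of o (w , r , V) = valley-within o (length V) r V ℕ.≤-refl

  slots-split : ∀ {b m} {Nb : Fin n → Set} {c₁ c₂ y z} → Slots b m Nb (Sub E m) →
                Nb c₁ → Nb c₂ → c₁ ≢ c₂ →
                Sub E m c₁ y → Sub E m c₂ z → (y < m × m < z) ⊎ (z < m × m < y)
  slots-split {false} single n₁ n₂ c₁≢c₂ _ _ = ⊥-elim (c₁≢c₂ (single _ _ n₁ n₂))
  slots-split {true} (side , uniqueˡ , uniqueʳ) n₁ n₂ c₁≢c₂ s₁ s₂ with side _ n₁ | side _ n₂
  ... | inj₁ L₁ | inj₁ L₂ = ⊥-elim (c₁≢c₂ (uniqueˡ _ _ n₁ n₂ (L₁ _ here) (L₂ _ here)))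
  ... | inj₂ R₁ | inj₂ R₂ = ⊥-elim (c₁≢c₂ (uniqueʳ _ _ n₁ n₂ (R₁ _ here) (R₂ _ here)))
  ... | inj₁ L₁ | inj₂ R₂ = inj₁ (L₁ _ s₁ , R₂ _ s₂)
  ... | inj₂ R₁ | inj₁ L₂ = inj₂ (L₂ _ s₂ , R₁ _ s₁)

  straddle⇒single-slot : ∀ {b m} {Nb : Fin n → Set} {v a c} → Slots b m Nb (Sub E m) → Nb v →
                         Sub E m v a → Sub E m v c → a < m → m < c → b ≡ false
  straddle⇒single-slot {false} _ _ _ _ _ _ = refl
  straddle⇒single-slot {true} (side , _) nv sa sc a<m m<c with side _ nv
  ... | inj₁ L = ⊥-elim (<-asym (L _ sc) m<c)
  ... | inj₂ R = ⊥-elim (<-asym (R _ sa) a<m)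

  single-slot-unique : ∀ {b m} {Nb : Fin n → Set} {x y} → Slots b m Nb (Sub E m) → b ≡ false →
                       Nb x → Nb y → x ≡ y
  single-slot-unique {false} single _ nx ny = single _ _ nx ny

  slots-no-interleave : ∀ {b m} {Nb : Fin n → Set} {c₁ c₂ a b′ z} → Slots b m Nb (Sub E m) →
                        Nb c₁ → Nb c₂ → c₁ ≢ c₂ →
                        Sub E m c₁ a → Sub E m c₁ b′ → Sub E m c₂ z → a < z → ¬ z < b′
  slots-no-interleave sl n₁ n₂ c₁≢c₂ sa sb sz a<z z<b
    with slots-split sl n₁ n₂ c₁≢c₂ sa sz | slots-split sl n₁ n₂ c₁≢c₂ sb sz
  ... | inj₁ (_ , m<z) | inj₁ (b<m , _) = <-asym (<-trans z<b b<m) m<z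
  ... | inj₁ (_ , m<z) | inj₂ (z<m , _) = <-asym z<m m<z
  ... | inj₂ (z<m , m<a) | _ = <-asym (<-trans a<z z<m) m<a

module OnPermutree {n : ℕ} {δ : Fin n → Decoration} (T : Permutree δ) where
  open Tree (parent T) (antisym T) (connected T) (acyclic T) public

  E : Fin n → Fin n → Bool
  E = parent T

  outSlots : ∀ o m → Slots (twoSlots o (δ m)) m (Step o m) (Sub E m)
  outSlots down m = childSlots T m
  outSlots up m = parentSlots T m

  inSlots : ∀ o m → Slots (twoSlots (opposite o) (δ m)) m (λ c → Step o c m) (Sub E m)
  inSlots down m = parentSlots T m
  inSlots up m = childSlots T m

  toward-mutual⇒¬between : ∀ o {x y z c w′} → Step o x c → Sub E x c y → Toward o y x →
                           Adj E x w′ → w′ ≢ c → Sub E x w′ z → x < y → ¬ y < z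
  toward-mutual⇒¬between o {x} {y} {z} {c} xc sc yx xw′ w′≢c sz x<y y<z
    with valley-of o (c , xc , sc) yx
  ... | valley m c₁ c₂ q₁ q₂ c₁≢c₂ t₁ t₂ =
    slots-no-interleave (inSlots o m) q₂ q₁ (≢-sym c₁≢c₂) t₂ z-via-c₂ t₁ x<y y<z
    where
    mc₂ : Adj E m c₂
    mc₂ = adj-sym (step⇒adj q₂)
    m-via-c : Sub E x c m
    m-via-c with sub-exists (sub-≢ mc₂ t₂)
    ... | w , xw , sw with w ≟ c
    ...   | yes refl = sw
    ...   | no w≢c =
      ⊥-elim (c₁≢c₂ (sub-unique (adj-sym (step⇒adj q₁)) mc₂ t₁ (sub-through xw (step⇒adj xc) w≢c sw sc mc₂ t₂)))
    z-via-c₂ : Sub E m c₂ z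
    z-via-c₂ = sub-through (step⇒adj xc) xw′ (≢-sym w′≢c) m-via-c sz mc₂ t₂

  toward-trans : ∀ o {x y z} → x < y → y < z → Toward o x y → Toward o y z → Toward o x z
  toward-trans o {x} {y} x<y y<z (c , xc , sc) (d , yd , sd) with toward-total o (<⇒≢ (<-trans x<y y<z))
  ... | inj₁ xz = xz
  ... | inj₂ (w , xw , sw) =
    ⊥-elim (toward-mutual⇒¬between o xc sc (d , yd , x-via-d) (step⇒adj xw) (≢-sym c≢w) sw x<y y<z)
    where
    c≢w : c ≢ w
    c≢w refl = step-asym xc (step-opposite o xw)
    x-via-d : Sub E y d x
    x-via-d = sub-between (step⇒adj xc) (step⇒adj xw) c≢w sc sw (step⇒adj yd) sd

  toward⇒InC : ∀ {i j} → i < j → Toward down i j → InC T i j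
  toward⇒InC {i} = cubicAt (twoChildren (δ i)) (childSlots T i)
    where
    cubicAt : ∀ b {j} → Slots b i (Step down i) (Sub E i) → i < j → Toward down i j → CubicAt b E i j
    cubicAt false _ i<j (c , e , s) = i<j , c , e , s
    cubicAt true (side , _) i<j (c , e , s) with side c e
    ... | inj₁ L = ⊥-elim (<-asym i<j (L _ s))
    ... | inj₂ R = c , e , R _ here , s

  InC⇒toward : ∀ {i j} → InC T i j → i < j × Toward down i j
  InC⇒toward {i} = fromCubicAt (twoChildren (δ i)) (childSlots T i)
    where
    fromCubicAt : ∀ b {j} → Slots b i (Step down i) (Sub E i) → CubicAt b E i j → i < j × Toward down i j
    fromCubicAt false _ (i<j , c , e , s) = i<j , c , e , s
    fromCubicAt true (side , _) (c , e , i<c , s) with side c e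
    ... | inj₁ L = ⊥-elim (<-asym i<c (L _ here))
    ... | inj₂ R = R _ s , c , e , s

  ¬InC⇒toward-up : ∀ {i j} → i < j → ¬ InC T i j → Toward up i j
  ¬InC⇒toward-up i<j ¬ij = [ (λ t → ⊥-elim (¬ij (toward⇒InC i<j t))) , (λ t → t) ] (toward-total down (<⇒≢ i<j))

  InC-trans : ∀ {i j k} → i < j → j < k → InC T i j → InC T j k → InC T i k
  InC-trans i<j j<k ij jk =
    toward⇒InC (<-trans i<j j<k) (toward-trans down i<j j<k (proj₂ (InC⇒toward ij)) (proj₂ (InC⇒toward jk)))

  ¬InC-trans : ∀ {i j k} → i < j → j < k → ¬ InC T i j → ¬ InC T j k → ¬ InC T i k
  ¬InC-trans i<j j<k ¬ij ¬jk ik =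
    toward-exclusive down (proj₂ (InC⇒toward ik))
      (toward-trans up i<j j<k (¬InC⇒toward-up i<j ¬ij) (¬InC⇒toward-up j<k ¬jk))

  detour-below : ∀ o {p w q} → Adj E p w → Sub E p w q → w < p → w < q → Toward o w p → ¬ Toward o w q
  detour-below o pw sq w<p w<q (a , wa , sa) (b , wb , sb) with sub-unique (step⇒adj wa) (adj-sym pw) sa here
  ... | refl with slots-split (outSlots o _) wa wb (λ p≡b → sub-not-back pw sq (step⇒adj wb) sb (sym p≡b)) here sb
  ...   | inj₁ (p<w , _) = <-asym w<p p<w
  ...   | inj₂ (q<w , _) = <-asym w<q q<w

  detour-middle : ∀ o {p w q} → Adj E p w → Sub E p w q → Toward o p w → Toward (opposite o) w q →
                  twoSlots (opposite o) (δ w) ≢ false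
  detour-middle o pw sq (a , pa , sa) (u , wu , su) single with sub-unique (step⇒adj pa) pw sa here
  ... | refl = sub-not-back pw sq (step⇒adj wu) su (sym (single-slot-unique (inSlots o _) single pa (step-opposite o wu)))

  detour-above : ∀ o {p w q} → Step o p w → Sub E p w q → w ≢ q → p < q → q < w →
                 twoSlots (opposite o) (δ q) ≡ false × Toward (opposite o) q w
  detour-above o {p} {w} {q} pw sq w≢q p<q q<w with toward-total o {q} {p} (≢-sym (<⇒≢ p<q))
  ... | inj₂ (v , qv , sv) = straddle⇒single-slot (inSlots o q) (step-opposite o qv) sv w-via-v p<q q<w , v , qv , w-via-v
    where
    w-via-v : Sub E q v w
    w-via-v = sub-extend (step⇒adj qv) sv (step⇒adj pw) w≢q
  ... | inj₁ qp with valley-of o (w , pw , sq) qp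
  ...   | valley m c₁ c₂ q₁ q₂ c₁≢c₂ t₁ t₂ with w ≟ m
  ...     | yes refl with slots-split (inSlots o w) q₁ q₂ c₁≢c₂ t₁ t₂
  ...       | inj₁ (_ , w<p) = ⊥-elim (<-asym (<-trans p<q q<w) w<p)
  ...       | inj₂ (_ , w<q) = ⊥-elim (<-asym q<w w<q)
  detour-above o {p} {w} {q} pw sq w≢q p<q q<w | inj₁ qp | valley m c₁ c₂ q₁ q₂ c₁≢c₂ t₁ t₂ | no w≢m =
    ⊥-elim (slots-no-interleave (inSlots o m) q₂ q₁ (≢-sym c₁≢c₂) t₂
              (sub-extend (adj-sym (step⇒adj q₂)) t₂ (step⇒adj pw) w≢m) t₁ p<q q<w)

  adjacent-middle : ∀ o {p q r} → Adj E p q → p < r → r < q → Toward o p r → ¬ Toward o r q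
  adjacent-middle o {p} {q} {r} pq p<r r<q pr rq with valley-of o (toward-extend o (adj-sym pq) (≢-sym (<⇒≢ p<r)) rq) pr
  ... | valley m c₁ c₂ q₁ q₂ c₁≢c₂ t₁ t₂ with q ≟ m
  ...   | yes refl with slots-split (inSlots o q) q₁ q₂ c₁≢c₂ t₁ t₂
  ...     | inj₁ (_ , q<r) = <-asym r<q q<r
  ...     | inj₂ (_ , q<p) = <-asym (<-trans p<r r<q) q<p
  adjacent-middle o {p} {q} {r} pq p<r r<q pr rq | valley m c₁ c₂ q₁ q₂ c₁≢c₂ t₁ t₂ | no q≢m =
    slots-no-interleave (inSlots o m) q₁ q₂ c₁≢c₂ t₁ (sub-extend (adj-sym (step⇒adj q₁)) t₁ pq q≢m) t₂ p<r r<q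

  adjacent-middle-single-slot : ∀ o {p q r} → Adj E p q → p < r → r < q → Toward (opposite o) r q →
                                twoSlots (opposite o) (δ r) ≡ false
  adjacent-middle-single-slot o pq p<r r<q (u , ru , s) =
    straddle⇒single-slot (outSlots (opposite o) _) ru (sub-extend (step⇒adj ru) s (adj-sym pq) (<⇒≢ p<r)) s p<r r<q

  toward-shift : ∀ o {p q r} → Step o p q → p < q → q < r → twoSlots (opposite o) (δ q) ≡ false →
                 Toward o p r → Toward o q r
  toward-shift o {p} {q} pq p<q q<r single (c , pc , sc) with c ≟ q
  ... | no c≢q with slots-split (outSlots o p) pq pc (≢-sym c≢q) here sc
  ...   | inj₁ (q<p , _) = ⊥-elim (<-asym p<q q<p)
  ...   | inj₂ (r<p , _) = ⊥-elim (<-asym (<-trans p<q q<r) r<p)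
  toward-shift o {p} {q} pq p<q q<r single (c , pc , sc) | yes refl with sub-exists (<⇒≢ q<r)
  ... | v , qv , sv with adj⇒step o qv
  ...   | inj₁ q→v = v , q→v , sv
  ...   | inj₂ v→q = ⊥-elim (sub-not-back (step⇒adj pq) sc qv sv (sym (single-slot-unique (inSlots o q) single pq v→q)))

equal-card-uncrossed⇒⊆ : ∀ {m} (S₁ S₂ : Subset m) {P Q : Fin m → Set} →
                         (∀ j → j ∈ S₁ ⇔ P j) → (∀ j → j ∈ S₂ ⇔ Q j) → ∣ S₁ ∣ ≡ ∣ S₂ ∣ →
                         (∀ j k → P j → ¬ Q j → Q k → ¬ P k → ⊥) → ∀ j → P j → Q j
equal-card-uncrossed⇒⊆ S₁ S₂ S₁≈P S₂≈Q card uncrossed j pj with j ∈? S₂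
... | yes j∈S₂ = Equivalence.to (S₂≈Q j) j∈S₂
... | no j∉S₂ =
  ⊥-elim (ℕ.<-irrefl (sym card) (p⊂q⇒∣p∣<∣q∣ (S₂⊆S₁ , j , Equivalence.from (S₁≈P j) pj , j∉S₂)))
  where
  S₂⊆S₁ : S₂ ⊆ S₁
  S₂⊆S₁ {k} k∈S₂ with k ∈? S₁
  ... | yes k∈S₁ = k∈S₁
  ... | no k∉S₁ = ⊥-elim (uncrossed j k pj (λ qj → j∉S₂ (Equivalence.from (S₂≈Q j) qj))
                            (Equivalence.to (S₂≈Q k) k∈S₂) (λ pk → k∉S₁ (Equivalence.from (S₁≈P k) pk)))

module _ {n : ℕ} {δ : Fin n → Decoration} where

  RowIncluded : Permutree δ → Permutree δ → Fin n → Set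
  RowIncluded T₁ T₂ i = ∀ j → InC T₁ i j → InC T₂ i j

  SameRow : Permutree δ → Permutree δ → Fin n → Set
  SameRow T₁ T₂ i = RowIncluded T₁ T₂ i × RowIncluded T₂ T₁ i

  rows-uncrossed : (T₁ T₂ : Permutree δ) {i j k : Fin n} → i < j → j < k → RowIncluded T₂ T₁ j →
                   InC T₁ i j → ¬ InC T₂ i j → InC T₂ i k → ¬ InC T₁ i k → ⊥
  rows-uncrossed T₁ T₂ {i} {j} {k} i<j j<k row-j ij ¬ij ik ¬ik with OnPermutree.toward-total T₁ down (<⇒≢ j<k)
  ... | inj₁ jk = ¬ik (OnPermutree.InC-trans T₁ i<j j<k ij (OnPermutree.toward⇒InC T₁ j<k jk))
  ... | inj₂ jk = OnPermutree.¬InC-trans T₂ i<j j<k ¬ij ¬jk ik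
    where
    ¬jk : ¬ InC T₂ j k
    ¬jk c = OnPermutree.toward-exclusive T₁ down (proj₂ (OnPermutree.InC⇒toward T₁ (row-j _ c))) jk

  row-included : (T₁ T₂ : Permutree δ) (i : Fin n) → (∀ {j} → i < j → SameRow T₁ T₂ j) →
                 (S₁ S₂ : Subset n) → (∀ j → j ∈ S₁ ⇔ InC T₁ i j) → (∀ j → j ∈ S₂ ⇔ InC T₂ i j) →
                 ∣ S₁ ∣ ≡ ∣ S₂ ∣ → RowIncluded T₁ T₂ i
  row-included T₁ T₂ i later S₁ S₂ S₁≈C₁ S₂≈C₂ card =
    equal-card-uncrossed⇒⊆ S₁ S₂ S₁≈C₁ S₂≈C₂ card uncrossed
    where
    uncrossed : ∀ j k → InC T₁ i j → ¬ InC T₂ i j → InC T₂ i k → ¬ InC T₁ i k → ⊥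
    uncrossed j k ij ¬ij ik ¬ik with <-cmp j k
    ... | tri< j<k _ _ = rows-uncrossed T₁ T₂ i<j j<k (proj₂ (later i<j)) ij ¬ij ik ¬ik
      where
      i<j : i < j
      i<j = proj₁ (OnPermutree.InC⇒toward T₁ ij)
    ... | tri≈ _ refl _ = ¬ik ij
    ... | tri> _ _ k<j = rows-uncrossed T₂ T₁ i<k k<j (proj₁ (later i<k)) ik ¬ik ij ¬ij
      where
      i<k : i < k
      i<k = proj₁ (OnPermutree.InC⇒toward T₂ ik)

last-row-empty : ∀ {n} {δ : Fin (suc n) → Decoration} (T : Permutree δ) j → ¬ InC T (fromℕ n) j
last-row-empty T j c = ℕ.<⇒≱ (proj₁ (OnPermutree.InC⇒toward T c)) (≤fromℕ j)

module _ {n : ℕ} {δ : Fin (suc n) → Decoration} (T₁ T₂ : Permutree δ) (c : Fin n → ℕ)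
         (cubic₁ : IsCubicVector T₁ c) (cubic₂ : IsCubicVector T₂ c) where

  cubic-vector⇒same-row : ∀ i → SameRow T₁ T₂ i
  cubic-vector⇒same-row = All.wfRec >-wellFounded _ (SameRow T₁ T₂) same-row-from-later
    where
    same-row-from-later : ∀ i → (∀ {j} → i < j → SameRow T₁ T₂ j) → SameRow T₁ T₂ i
    same-row-from-later i later with view i
    ... | ‵fromℕ = (λ j c → ⊥-elim (last-row-empty T₁ j c)) , (λ j c → ⊥-elim (last-row-empty T₂ j c))
    ... | ‵inj₁ {i = i′} _ with cubic₁ i′ | cubic₂ i′
    ...   | S₁ , S₁≈C₁ , ∣S₁∣≡c | S₂ , S₂≈C₂ , ∣S₂∣≡c =
      row-included T₁ T₂ _ later S₁ S₂ S₁≈C₁ S₂≈C₂ card ,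
      row-included T₂ T₁ _ (λ i<j → swap (later i<j)) S₂ S₁ S₂≈C₂ S₁≈C₁ (sym card)
      where
      card : ∣ S₁ ∣ ≡ ∣ S₂ ∣
      card = trans ∣S₁∣≡c (sym ∣S₂∣≡c)

SameOrientation : ∀ {n} {δ : Fin n → Decoration} → Permutree δ → Permutree δ → Set
SameOrientation T₁ T₂ = ∀ o {x y} → x < y → OnPermutree.Toward T₁ o x y → OnPermutree.Toward T₂ o x y

module _ {n : ℕ} {δ : Fin n → Decoration} (T₁ T₂ : Permutree δ) where
  private
    module A = OnPermutree T₁
    module B = OnPermutree T₂

  same-row⇒same-orientation : (∀ i → SameRow T₁ T₂ i) → SameOrientation T₁ T₂
  same-row⇒same-orientation same down x<y xy = proj₂ (B.InC⇒toward (proj₁ (same _) _ (A.toward⇒InC x<y xy)))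
  same-row⇒same-orientation same up x<y xy with B.toward-total down (<⇒≢ x<y)
  ... | inj₁ xy₂ = ⊥-elim (A.toward-exclusive down (proj₂ (A.InC⇒toward (proj₂ (same _) _ (B.toward⇒InC x<y xy₂)))) xy)
  ... | inj₂ xy₂ = xy₂

module _ {n : ℕ} {δ : Fin n → Decoration} (T₁ T₂ : Permutree δ)
         (to : SameOrientation T₁ T₂) (from : SameOrientation T₂ T₁) where
  private
    module A = OnPermutree T₁
    module B = OnPermutree T₂

  detour-not-below : ∀ {p q w} → p < q → Adj A.E p q → Adj B.E p w → Sub B.E p w q → w ≢ q → ¬ w < p
  detour-not-below {p} {q} {w} p<q pq pw sq w≢q w<p = [ impossible down , impossible up ] (A.toward-total down (<⇒≢ w<p))
    where
    w<q : w < q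
    w<q = <-trans w<p p<q
    impossible : ∀ o → A.Toward o w p → ⊥
    impossible o wp = B.detour-below o pw sq w<p w<q (to o w<p wp) (to o w<q (A.toward-extend o pq w≢q wp))

  detour-not-between : ∀ {p q w} → Adj A.E p q → Adj B.E p w → Sub B.E p w q → p < w → ¬ w < q
  detour-not-between {p} {q} {w} pq pw sq p<w w<q = [ impossible down , impossible up ] (A.toward-total down (<⇒≢ p<w))
    where
    impossible : ∀ o → A.Toward o p w → ⊥
    impossible o pw₁ with A.toward-total o (<⇒≢ w<q)
    ... | inj₁ wq₁ = A.adjacent-middle o pq p<w w<q pw₁ wq₁
    ... | inj₂ wq₁ = B.detour-middle o pw sq (to o p<w pw₁) (to (opposite o) w<q wq₁)
                       (A.adjacent-middle-single-slot o pq p<w w<q wq₁)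

  detour-not-above : ∀ o {p q w} → p < q → A.Step o p q → B.Step o p w → Sub B.E p w q → w ≢ q → ¬ q < w
  detour-not-above o {p} {q} {w} p<q pq pw sq w≢q q<w with B.detour-above o pw sq w≢q p<q q<w
  ... | single , qw₂ =
    B.toward-exclusive o (to o q<w (A.toward-shift o pq p<q q<w single (from o (<-trans p<q q<w) (w , pw , here)))) qw₂

  adjacent-transfer : ∀ {p q} → p < q → Adj A.E p q → Adj B.E p q
  adjacent-transfer {p} {q} p<q pq with B.sub-exists (<⇒≢ p<q)
  ... | w , pw , sq with w ≟ q
  ...   | yes refl = pw
  ...   | no w≢q = ⊥-elim ([ misdirected down , misdirected up ] (B.adj⇒step down pw))
    where
    misdirected : ∀ o → B.Step o p w → ⊥
    misdirected o pw-o with from o p<q (w , pw-o , sq)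
    ... | c , pc , sc with A.sub-unique (A.step⇒adj pc) pq sc here
    ...   | refl with <-cmp w p
    ...     | tri< w<p _ _ = detour-not-below p<q pq pw sq w≢q w<p
    ...     | tri≈ _ w≡p _ = B.adj⇒≢ pw (sym w≡p)
    ...     | tri> _ _ p<w with <-cmp w q
    ...       | tri< w<q _ _ = detour-not-between pq pw sq p<w w<q
    ...       | tri≈ _ w≡q _ = w≢q w≡q
    ...       | tri> _ _ q<w = detour-not-above o p<q pc pw-o sq w≢q q<w

  step-transfer : ∀ o {x y} → x < y → A.Step o x y → B.Step o x y
  step-transfer o {x} {y} x<y xy with to o x<y (y , xy , here)
  ... | c , xc , sc with B.sub-unique (B.step⇒adj xc) (adjacent-transfer x<y (A.step⇒adj xy)) sc here
  ...   | refl = xc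

  edge-transfer : ∀ p q → parent T₁ p q ≡ true → parent T₂ p q ≡ true
  edge-transfer p q e with <-cmp p q
  ... | tri< p<q _ _ = step-transfer down p<q e
  ... | tri≈ _ refl _ = ⊥-elim (A.adj-irrefl (inj₁ e))
  ... | tri> _ _ q<p = step-transfer up q<p e

theorem3p18 : (n : ℕ) (δ : Fin n → Decoration) (T₁ T₂ : Permutree δ)
    (c : Fin (n ∸ 1) → ℕ) → IsCubicVector T₁ c → IsCubicVector T₂ c →
    ∀ p q → parent T₁ p q ≡ parent T₂ p q
theorem3p18 zero δ T₁ T₂ c cubic₁ cubic₂ () q
theorem3p18 (suc n) δ T₁ T₂ c cubic₁ cubic₂ p q =
  ⇔→≡ (mk⇔ (edge-transfer T₁ T₂ to from p q) (edge-transfer T₂ T₁ from to p q))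
  where
  same : ∀ i → SameRow T₁ T₂ i
  same = cubic-vector⇒same-row T₁ T₂ c cubic₁ cubic₂
  to : SameOrientation T₁ T₂
  to = same-row⇒same-orientation T₁ T₂ same
  from : SameOrientation T₂ T₁
  from = same-row⇒same-orientation T₂ T₁ (λ i → swap (same i))
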